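{- Let $\mathcal{M}=\langle M,\mathcal{S}^{\mathcal{M}},\in^{\mathcal{M}}\rangle$ be a model of $\mathrm{BAC}^+$. Then $\langle M,\mathcal{S}^{\mathcal{M}},\subseteq^{\mathcal{M}}\rangle$ is a model of $\mathrm{IABA}_{\mathrm{Ideal}}$ (with $\mathcal{S}^{\mathcal{M}}$ interpreting $\mathcal{I}$) and $\mathcal{S}^{\mathcal{M}}$ has the same cardinality as the set of atoms of $\langle M,\subseteq^{\mathcal{M}}\rangle$.
   Context: $\mathcal{L}_{cl}$ has binary $\in$ and unary $\mathcal{S}$; elements of $\mathcal{S}^{\mathcal{M}}$ are sets, all elements are classes (lowercase variables over sets, uppercase over classes). $\mathrm{BAC}$ has axioms: (Mem) if $X\in Y$ then $X$ is a set; (Subset) if $x$ is a set and every set in $X$ is in $x$ then $X$ is a set; (Emp) there is a set with no set members; (Adj) for sets $x,y$ there is a set whose set members are exactly those of $x$ together with $y$; (CExt) classes with the same set members are equal; (Union) for sets $x,y$ there is a set whose set members are those in $x$ or $y$; (UB) for every set $x$ there is a set $y\notin x$; (CUnion),(CIntersection) closure of classes under union and intersection; (CComp) every class $X$ has a class whose set members are exactly the sets not in $X$. $\mathrm{BAC}^+$ is $\mathrm{BAC}$ plus (Sep): for every class $X$ that is not a set there is a class $Y\subseteq X$ such that neither $Y$ nor $X\setminus Y$ (the class of sets in $X$ not in $Y$) is a set. $X\subseteq^{\mathcal{M}}Y$ iff every set member of $X$ is a member of $Y$. $\mathrm{IABA}$ is the theory of infinite atomic Boolean algebras in $\{\sqsubseteq\}$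 (distributive complemented lattice order with $0$, $1$, every nonzero element above an atom, infinitely many atoms; complement written $\dotminus$, meet $\dot\land$). $\mathrm{IABA}_{\mathrm{Ideal}}$ is the theory in the language $\{\sqsubseteq,\mathcal{I}\}$ extending $\mathrm{IABA}$ with axioms: $\mathcal{I}$ is a proper ideal (contains $0$, not $1$, closed under binary joins, downward closed); for each $n\in\mathbb{N}$, every element with at most $n$ atoms below it is in $\mathcal{I}$; and $\forall x(\neg\mathcal{I}(x)\Rightarrow\exists y(y\sqsubseteq x\land\neg\mathcal{I}(y)\land\neg\mathcal{I}(x\dot\land\dotminus y)))$. -}

module Defs where

open import Level using (Level; _⊔_) renaming (suc to lsuc)
open import Data.Nat using (ℕ; suc)
open import Data.Fin using (Fin)
open import Data.Product using (Σ; ∃; _×_; _,_)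
open import Data.Sum using (_⊎_)
open import Relation.Nullary using (¬_)
open import Relation.Binary.PropositionalEquality using (_≡_)

_⟺_ : ∀ {a b} → Set a → Set b → Set (a ⊔ b)
A ⟺ B = (A → B) × (B → A)
infix 3 _⟺_

-- The class theory BAC and BAC⁺ (language: ∈ binary, 𝒮 unary).
-- Structures are ⟨M, S, _∈_⟩; equality is interpreted by _≡_.

module ClassTheory {ℓ : Level} {M : Set ℓ} (S : M → Set ℓ) (_∈_ : M → M → Set ℓ) where

  infix 5 _⊆ᴹ_

  _⊆ᴹ_ : M → M → Set ℓ
  X ⊆ᴹ Y = ∀ z → S z → z ∈ X → z ∈ Y

  record BAC : Set ℓ where
    field
      Mem    : ∀ X Y → X ∈ Y → S X
      Subset : ∀ x X → S x → (∀ z → S z → z ∈ X → z ∈ x) → S X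
      Emp    : ∃ λ e → S e × (∀ z → S z → ¬ (z ∈ e))
      Adj    : ∀ x y → S x → S y →
               ∃ λ w → S w × (∀ z → S z → (z ∈ w ⟺ (z ∈ x ⊎ z ≡ y)))
      CExt   : ∀ X Y → (∀ z → S z → (z ∈ X ⟺ z ∈ Y)) → X ≡ Y
      Union  : ∀ x y → S x → S y →
               ∃ λ w → S w × (∀ z → S z → (z ∈ w ⟺ (z ∈ x ⊎ z ∈ y)))
      UB     : ∀ x → S x → ∃ λ y → S y × ¬ (y ∈ x)
      CUnion : ∀ X Y → ∃ λ Z → ∀ z → S z → (z ∈ Z ⟺ (z ∈ X ⊎ z ∈ Y))
      CIntersection : ∀ X Y → ∃ λ Z → ∀ z → S z → (z ∈ Z ⟺ (z ∈ X × z ∈ Y))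
      CComp  : ∀ X → ∃ λ Y → ∀ z → S z → (z ∈ Y ⟺ (¬ (z ∈ X)))

  IsDiff : M → M → M → Set ℓ
  IsDiff X Y D = ∀ z → S z → (z ∈ D ⟺ (z ∈ X × ¬ (z ∈ Y)))

  record BAC⁺ : Set ℓ where
    field
      bac : BAC
      Sep : ∀ X → ¬ S X →
            ∃ λ Y → Y ⊆ᴹ X × ¬ S Y × (∀ D → IsDiff X Y D → ¬ S D)

-- Infinite atomic Boolean algebras in the language {⊑}, and the
-- extension IABA_Ideal in the language {⊑, 𝓘}.  All operations are
-- expressed through the order, as definable notions.

module Order {ℓ : Level} {M : Set ℓ} (_⊑_ : M → M → Set ℓ) where

  IsBottom : M → Set ℓ
  IsBottom b = ∀ z → b ⊑ z

  IsTop : M → Set ℓ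
  IsTop t = ∀ z → z ⊑ t

  IsMeet : M → M → M → Set ℓ
  IsMeet x y m = m ⊑ x × m ⊑ y × (∀ z → z ⊑ x → z ⊑ y → z ⊑ m)

  IsJoin : M → M → M → Set ℓ
  IsJoin x y j = x ⊑ j × y ⊑ j × (∀ z → x ⊑ z → y ⊑ z → j ⊑ z)

  IsCompl : M → M → Set ℓ
  IsCompl x c = (∀ m → IsMeet x c m → IsBottom m) × (∀ j → IsJoin x c j → IsTop j)

  IsAtom : M → Set ℓ
  IsAtom a = ¬ IsBottom a × (∀ b → b ⊑ a → IsBottom b ⊎ b ≡ a)

  DistinctAtomsBelow : (n : ℕ) → M → (Fin n → M) → Set ℓ
  DistinctAtomsBelow n x f =
    (∀ i j → f i ≡ f j → i ≡ j) × (∀ i → IsAtom (f i) × f i ⊑ x)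

  record IABA : Set ℓ where
    field
      refl⊑    : ∀ x → x ⊑ x
      antisym⊑ : ∀ x y → x ⊑ y → y ⊑ x → x ≡ y
      trans⊑   : ∀ x y z → x ⊑ y → y ⊑ z → x ⊑ z
      meets    : ∀ x y → ∃ λ m → IsMeet x y m
      joins    : ∀ x y → ∃ λ j → IsJoin x y j
      bottom   : ∃ λ b → IsBottom b
      top      : ∃ λ t → IsTop t
      distrib  : ∀ x y z j m m₁ m₂ j' →
                 IsJoin y z j → IsMeet x j m →
                 IsMeet x y m₁ → IsMeet x z m₂ → IsJoin m₁ m₂ j' → m ≡ j'
      compl    : ∀ x → ∃ λ c → IsCompl x c
      atomic   : ∀ x → ¬ IsBottom x → ∃ λ a → IsAtom a × a ⊑ x
      -- infinitely many atoms: for each n, there are at least n atoms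
      infAtoms : ∀ n → ∃ λ (f : Fin n → M) →
                 (∀ i j → f i ≡ f j → i ≡ j) × (∀ i → IsAtom (f i))

  record IABA-Ideal (𝓘 : M → Set ℓ) : Set ℓ where
    field
      iaba      : IABA
      ideal-0   : ∀ b → IsBottom b → 𝓘 b
      ideal-¬1  : ∀ t → IsTop t → ¬ 𝓘 t
      ideal-∨   : ∀ x y j → IsJoin x y j → 𝓘 x → 𝓘 y → 𝓘 j
      ideal-↓   : ∀ x y → x ⊑ y → 𝓘 y → 𝓘 x
      -- for each n: any element with at most n atoms below it is in 𝓘
      finite    : ∀ n x → (∀ f → ¬ DistinctAtomsBelow (suc n) x f) → 𝓘 x
      split     : ∀ x → ¬ 𝓘 x →
                  ∃ λ y → y ⊑ x × ¬ 𝓘 y ×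
                    (∀ c m → IsCompl y c → IsMeet x c m → ¬ 𝓘 m)

-- Two subclasses P, Q of M have the same cardinality: there is a
-- function M → M restricting to a bijection from P onto Q.

SameCard : ∀ {ℓ} {M : Set ℓ} → (M → Set ℓ) → (M → Set ℓ) → Set ℓ
SameCard {M = M} P Q =
  Σ (M → M) λ f →
    (∀ x → P x → Q (f x)) ×
    (∀ x y → P x → P y → f x ≡ f y → x ≡ y) ×
    (∀ y → Q y → ∃ λ x → P x × f x ≡ y)

-- Since ⊆ᴹ compares set members and classes are extensional, a model of BAC
-- is the power-class algebra of its sets: meets, joins and complements are
-- intersections, unions and class complements, and the atoms are exactly the
-- singletons {x} of sets, so x ↦ {x} matches sets with atoms.  Sets form an
-- ideal by Subset, Union and UB; a class with at most n atoms has at most n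
-- set members, so it lies inside a set built by n uses of Adj; and once the meet of X
-- with the complement of Y is identified with X ∖ Y, Sep is the splitting
-- axiom.  Excluded middle is used to decide membership and to find members
-- of nonempty classes.
module Submission where

open import Defs
open import Level using (Level)
open import Data.Product using (_×_; Σ; ∃; _,_; proj₁; proj₂)
open import Data.Sum using (_⊎_; inj₁; inj₂; [_,_])
open import Data.Empty using (⊥-elim)
open import Data.Nat using (ℕ; zero; suc)
open import Data.Fin using (Fin; zero; suc)
open import Data.Vec.Functional using (_∷_)
open import Relation.Nullary using (¬_; Dec; yes; no)
open import Relation.Nullary.Decidable using (decidable-stable)
open import Relation.Binary.PropositionalEquality
  using (_≡_; _≢_; refl; sym; trans; cong; subst)
open import Axiom.ExcludedMiddle using (ExcludedMiddle)

∷-injective : ∀ {a} {A : Set a} {n} {x : A} {g : Fin n → A} →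
              (∀ i → g i ≢ x) → (∀ i j → g i ≡ g j → i ≡ j) →
              ∀ i j → (x ∷ g) i ≡ (x ∷ g) j → i ≡ j
∷-injective fresh inj zero    zero    _  = refl
∷-injective fresh inj zero    (suc j) eq = ⊥-elim (fresh j (sym eq))
∷-injective fresh inj (suc i) zero    eq = ⊥-elim (fresh i eq)
∷-injective fresh inj (suc i) (suc j) eq = cong suc (inj i j eq)

module BACModel {ℓ : Level} (em : ExcludedMiddle ℓ) {M : Set ℓ} (S : M → Set ℓ)
  (_∈_ : M → M → Set ℓ) (bac : ClassTheory.BAC S _∈_) where
  open ClassTheory S _∈_
  open BAC bac
  open Order _⊆ᴹ_

  ∅ : M
  ∅ = proj₁ Emp

  ∅-set : S ∅
  ∅-set = proj₁ (proj₂ Emp)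

  ∉∅ : ∀ z → S z → ¬ z ∈ ∅
  ∉∅ = proj₂ (proj₂ Emp)

  infixl 25 _∩_ _∪_

  _∩_ : M → M → M
  X ∩ Y = proj₁ (CIntersection X Y)

  ∈∩ : ∀ X Y z → S z → (z ∈ X ∩ Y ⟺ (z ∈ X × z ∈ Y))
  ∈∩ X Y = proj₂ (CIntersection X Y)

  _∪_ : M → M → M
  X ∪ Y = proj₁ (CUnion X Y)

  ∈∪ : ∀ X Y z → S z → (z ∈ X ∪ Y ⟺ (z ∈ X ⊎ z ∈ Y))
  ∈∪ X Y = proj₂ (CUnion X Y)

  ∁ : M → M
  ∁ X = proj₁ (CComp X)

  ∈∁ : ∀ X z → S z → (z ∈ ∁ X ⟺ (¬ z ∈ X))
  ∈∁ X = proj₂ (CComp X)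

  singleton : (x : M) → S x → M
  singleton x sx = proj₁ (Adj ∅ x ∅-set sx)

  ∈-singleton : ∀ x (sx : S x) → x ∈ singleton x sx
  ∈-singleton x sx = proj₂ (proj₂ (proj₂ (Adj ∅ x ∅-set sx)) x sx) (inj₂ refl)

  ∈-singleton⇒≡ : ∀ {x} {sx : S x} z → S z → z ∈ singleton x sx → z ≡ x
  ∈-singleton⇒≡ {x} {sx} z sz z∈ with proj₁ (proj₂ (proj₂ (Adj ∅ x ∅-set sx)) z sz) z∈
  ... | inj₁ z∈∅ = ⊥-elim (∉∅ z sz z∈∅)
  ... | inj₂ z≡x = z≡x

  singleton⊆ᴹ : ∀ {x X} (sx : S x) → x ∈ X → singleton x sx ⊆ᴹ X
  singleton⊆ᴹ {X = X} sx x∈X z sz z∈ = subst (_∈ X) (sym (∈-singleton⇒≡ z sz z∈)) x∈X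

  singleton-irrelevant : ∀ x (sx sx′ : S x) → singleton x sx ≡ singleton x sx′
  singleton-irrelevant x sx sx′ =
    CExt _ _ λ z sz → singleton⊆ᴹ sx (∈-singleton x sx′) z sz ,
                      singleton⊆ᴹ sx′ (∈-singleton x sx) z sz

  IsBottom⇒empty : ∀ {b} → IsBottom b → ∀ z → S z → ¬ z ∈ b
  IsBottom⇒empty b⊆ z sz z∈b = ∉∅ z sz (b⊆ ∅ z sz z∈b)

  empty⇒IsBottom : ∀ {b} → (∀ z → S z → ¬ z ∈ b) → IsBottom b
  empty⇒IsBottom empty Y z sz z∈b = ⊥-elim (empty z sz z∈b)

  ¬IsBottom⇒member : ∀ {x} → ¬ IsBottom x → ∃ λ z → S z × z ∈ x
  ¬IsBottom⇒member ¬bot = decidable-stable em λ none →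
    ¬bot (empty⇒IsBottom λ z sz z∈x → none (z , sz , z∈x))

  IsTop⇒∋ : ∀ {t} → IsTop t → ∀ z → S z → z ∈ t
  IsTop⇒∋ top z sz = top (singleton z sz) z sz (∈-singleton z sz)

  ∩-IsMeet : ∀ X Y → IsMeet X Y (X ∩ Y)
  ∩-IsMeet X Y = (λ z sz z∈ → proj₁ (proj₁ (∈∩ X Y z sz) z∈)) ,
                 (λ z sz z∈ → proj₂ (proj₁ (∈∩ X Y z sz) z∈)) ,
                 (λ W W⊆X W⊆Y z sz z∈W → proj₂ (∈∩ X Y z sz) (W⊆X z sz z∈W , W⊆Y z sz z∈W))

  ∪-IsJoin : ∀ X Y → IsJoin X Y (X ∪ Y)
  ∪-IsJoin X Y = (λ z sz z∈ → proj₂ (∈∪ X Y z sz) (inj₁ z∈)) ,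
                 (λ z sz z∈ → proj₂ (∈∪ X Y z sz) (inj₂ z∈)) ,
                 λ W X⊆W Y⊆W z sz z∈ → [ X⊆W z sz , Y⊆W z sz ] (proj₁ (∈∪ X Y z sz) z∈)

  IsMeet⇒∈⟺ : ∀ {X Y m} → IsMeet X Y m → ∀ z → S z → (z ∈ m ⟺ (z ∈ X × z ∈ Y))
  IsMeet⇒∈⟺ (m⊆X , m⊆Y , glb) z sz =
    (λ z∈m → m⊆X z sz z∈m , m⊆Y z sz z∈m) ,
    λ (z∈X , z∈Y) → glb _ (singleton⊆ᴹ sz z∈X) (singleton⊆ᴹ sz z∈Y) z sz (∈-singleton z sz)

  IsJoin⇒∈⟺ : ∀ {X Y j} → IsJoin X Y j → ∀ z → S z → (z ∈ j ⟺ (z ∈ X ⊎ z ∈ Y))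
  IsJoin⇒∈⟺ {X} {Y} (X⊆j , Y⊆j , lub) z sz =
    (λ z∈j → proj₁ (∈∪ X Y z sz) (lub (X ∪ Y) X⊆X∪Y Y⊆X∪Y z sz z∈j)) ,
    λ { (inj₁ z∈X) → X⊆j z sz z∈X ; (inj₂ z∈Y) → Y⊆j z sz z∈Y }
    where
    X⊆X∪Y : X ⊆ᴹ X ∪ Y
    X⊆X∪Y = proj₁ (∪-IsJoin X Y)
    Y⊆X∪Y : Y ⊆ᴹ X ∪ Y
    Y⊆X∪Y = proj₁ (proj₂ (∪-IsJoin X Y))

  IsCompl⇒∈⟺ : ∀ {X c} → IsCompl X c → ∀ z → S z → (z ∈ c ⟺ (¬ z ∈ X))
  IsCompl⇒∈⟺ {X} {c} (meet-bot , join-top) z sz =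
    (λ z∈c z∈X → IsBottom⇒empty (meet-bot (X ∩ c) (∩-IsMeet X c)) z sz
                   (proj₂ (∈∩ X c z sz) (z∈X , z∈c))) ,
    λ z∉X → [ (λ z∈X → ⊥-elim (z∉X z∈X)) , (λ z∈c → z∈c) ]
              (proj₁ (IsJoin⇒∈⟺ (∪-IsJoin X c) z sz)
                     (IsTop⇒∋ (join-top (X ∪ c) (∪-IsJoin X c)) z sz))

  ∁-IsCompl : ∀ X → IsCompl X (∁ X)
  ∁-IsCompl X =
    (λ m isMeet → empty⇒IsBottom λ z sz z∈m →
       let (z∈X , z∈∁X) = proj₁ (IsMeet⇒∈⟺ isMeet z sz) z∈m
       in proj₁ (∈∁ X z sz) z∈∁X z∈X) ,
    λ j isJoin Y z sz _ → proj₂ (IsJoin⇒∈⟺ isJoin z sz) (decide z sz (em {z ∈ X}))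
    where
    decide : ∀ z → S z → Dec (z ∈ X) → z ∈ X ⊎ z ∈ ∁ X
    decide z sz (yes z∈X) = inj₁ z∈X
    decide z sz (no z∉X)  = inj₂ (proj₂ (∈∁ X z sz) z∉X)

  distributive : ∀ x y z j m m₁ m₂ j′ → IsJoin y z j → IsMeet x j m →
                 IsMeet x y m₁ → IsMeet x z m₂ → IsJoin m₁ m₂ j′ → m ≡ j′
  distributive x y z j m m₁ m₂ j′ y∨z x∧j x∧y x∧z m₁∨m₂ =
    CExt m j′ λ w sw → to w sw , from w sw
    where
    to : ∀ w → S w → w ∈ m → w ∈ j′
    to w sw w∈m with proj₁ (IsMeet⇒∈⟺ x∧j w sw) w∈m
    ... | w∈x , w∈j with proj₁ (IsJoin⇒∈⟺ y∨z w sw) w∈j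
    ... | inj₁ w∈y = proj₂ (IsJoin⇒∈⟺ m₁∨m₂ w sw) (inj₁ (proj₂ (IsMeet⇒∈⟺ x∧y w sw) (w∈x , w∈y)))
    ... | inj₂ w∈z = proj₂ (IsJoin⇒∈⟺ m₁∨m₂ w sw) (inj₂ (proj₂ (IsMeet⇒∈⟺ x∧z w sw) (w∈x , w∈z)))
    from : ∀ w → S w → w ∈ j′ → w ∈ m
    from w sw w∈j′ with proj₁ (IsJoin⇒∈⟺ m₁∨m₂ w sw) w∈j′
    ... | inj₁ w∈m₁ = let (w∈x , w∈y) = proj₁ (IsMeet⇒∈⟺ x∧y w sw) w∈m₁ in
      proj₂ (IsMeet⇒∈⟺ x∧j w sw) (w∈x , proj₂ (IsJoin⇒∈⟺ y∨z w sw) (inj₁ w∈y))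
    ... | inj₂ w∈m₂ = let (w∈x , w∈z) = proj₁ (IsMeet⇒∈⟺ x∧z w sw) w∈m₂ in
      proj₂ (IsMeet⇒∈⟺ x∧j w sw) (w∈x , proj₂ (IsJoin⇒∈⟺ y∨z w sw) (inj₂ w∈z))

  singleton-IsAtom : ∀ x (sx : S x) → IsAtom (singleton x sx)
  singleton-IsAtom x sx =
    (λ bot → IsBottom⇒empty bot x sx (∈-singleton x sx)) ,
    λ b b⊆ → byMembership b b⊆ (em {x ∈ b})
    where
    byMembership : ∀ b → b ⊆ᴹ singleton x sx → Dec (x ∈ b) → IsBottom b ⊎ b ≡ singleton x sx
    byMembership b b⊆ (yes x∈b) = inj₂ (CExt _ _ λ z sz → b⊆ z sz , singleton⊆ᴹ sx x∈b z sz)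
    byMembership b b⊆ (no x∉b)  = inj₁ (empty⇒IsBottom λ z sz z∈b →
                                    x∉b (subst (_∈ b) (∈-singleton⇒≡ z sz (b⊆ z sz z∈b)) z∈b))

  IsAtom⇒singleton : ∀ {a} → IsAtom a → ∃ λ z → Σ (S z) λ sz → singleton z sz ≡ a
  IsAtom⇒singleton (¬bot , minimal) with ¬IsBottom⇒member ¬bot
  ... | z , sz , z∈a with minimal (singleton z sz) (singleton⊆ᴹ sz z∈a)
  ... | inj₁ bot = ⊥-elim (IsBottom⇒empty bot z sz (∈-singleton z sz))
  ... | inj₂ eq  = z , sz , eq

  record SetWithDistinctMembers (n : ℕ) : Set ℓ where
    field
      set            : M
      set-isSet      : S set
      member         : Fin n → M
      member-isSet   : ∀ i → S (member i)
      member-∈       : ∀ i → member i ∈ set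
      member-injective : ∀ i j → member i ≡ member j → i ≡ j

  module _ {n} (s : SetWithDistinctMembers n) where
    open SetWithDistinctMembers s

    withFreshMember : SetWithDistinctMembers (suc n)
    withFreshMember with UB set set-isSet
    ... | y , sy , y∉set with Adj set y set-isSet sy
    ... | w , sw , ∈w = record
      { set = w ; set-isSet = sw ; member = y ∷ member ; member-isSet = isSet
      ; member-∈ = ∈-w
      ; member-injective = ∷-injective (λ i eq → y∉set (subst (_∈ set) eq (member-∈ i)))
                                        member-injective }
      where
      isSet : ∀ i → S ((y ∷ member) i)
      isSet zero    = sy
      isSet (suc i) = member-isSet i
      ∈-w : ∀ i → (y ∷ member) i ∈ w
      ∈-w zero    = proj₂ (∈w y sy) (inj₂ refl)
      ∈-w (suc i) = proj₂ (∈w (member i) (member-isSet i)) (inj₁ (member-∈ i))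

  setWithDistinctMembers : ∀ n → SetWithDistinctMembers n
  setWithDistinctMembers zero = record
    { set = ∅ ; set-isSet = ∅-set ; member = λ () ; member-isSet = λ ()
    ; member-∈ = λ () ; member-injective = λ () }
  setWithDistinctMembers (suc n) = withFreshMember (setWithDistinctMembers n)

  -- Off the sets atomOf is junk (the identity); only its restriction to sets matters.
  atomOf : M → M
  atomOf x with em {S x}
  ... | yes sx = singleton x sx
  ... | no _   = x

  atomOf-set : ∀ x (sx : S x) → atomOf x ≡ singleton x sx
  atomOf-set x sx with em {S x}
  ... | yes sx′ = singleton-irrelevant x sx′ sx
  ... | no ¬sx  = ⊥-elim (¬sx sx)

  atomOf-IsAtom : ∀ x → S x → IsAtom (atomOf x)
  atomOf-IsAtom x sx = subst IsAtom (sym (atomOf-set x sx)) (singleton-IsAtom x sx)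

  atomOf-injective : ∀ x y → S x → S y → atomOf x ≡ atomOf y → x ≡ y
  atomOf-injective x y sx sy eq =
    ∈-singleton⇒≡ x sx (subst (x ∈_) (trans (sym (atomOf-set x sx)) (trans eq (atomOf-set y sy)))
                                      (∈-singleton x sx))

  atomOf-surjective : ∀ a → IsAtom a → ∃ λ x → S x × atomOf x ≡ a
  atomOf-surjective a isAtom with IsAtom⇒singleton isAtom
  ... | z , sz , eq = z , sz , trans (atomOf-set z sz) eq

  sets≈atoms : SameCard S IsAtom
  sets≈atoms = atomOf , atomOf-IsAtom , atomOf-injective , atomOf-surjective

  isIABA : IABA
  isIABA = record
    { refl⊑    = λ x z sz z∈x → z∈x
    ; antisym⊑ = λ x y x⊆y y⊆x → CExt x y λ z sz → x⊆y z sz , y⊆x z sz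
    ; trans⊑   = λ x y w x⊆y y⊆w z sz z∈x → y⊆w z sz (x⊆y z sz z∈x)
    ; meets    = λ x y → x ∩ y , ∩-IsMeet x y
    ; joins    = λ x y → x ∪ y , ∪-IsJoin x y
    ; bottom   = ∅ , empty⇒IsBottom ∉∅
    ; top      = ∁ ∅ , λ Y z sz _ → proj₂ (∈∁ ∅ z sz) (∉∅ z sz)
    ; distrib  = distributive
    ; compl    = λ x → ∁ x , ∁-IsCompl x
    ; atomic   = λ x ¬bot → let (z , sz , z∈x) = ¬IsBottom⇒member ¬bot in
                   singleton z sz , singleton-IsAtom z sz , singleton⊆ᴹ sz z∈x
    ; infAtoms = λ n → let open SetWithDistinctMembers (setWithDistinctMembers n) in
                   (λ i → atomOf (member i)) ,
                   (λ i j eq → member-injective i j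
                      (atomOf-injective _ _ (member-isSet i) (member-isSet j) eq)) ,
                   (λ i → atomOf-IsAtom (member i) (member-isSet i))
    }

  IsBottom⇒set : ∀ b → IsBottom b → S b
  IsBottom⇒set b b⊆ = Subset ∅ b ∅-set (b⊆ ∅)

  IsTop⇒¬set : ∀ t → IsTop t → ¬ S t
  IsTop⇒¬set t top st = let (y , sy , y∉t) = UB t st in y∉t (IsTop⇒∋ top y sy)

  IsJoin-set : ∀ x y j → IsJoin x y j → S x → S y → S j
  IsJoin-set x y j isJoin sx sy with Union x y sx sy
  ... | u , su , ∈u = Subset u j su λ z sz z∈j → proj₂ (∈u z sz) (proj₁ (IsJoin⇒∈⟺ isJoin z sz) z∈j)

  ⊆ᴹ-set : ∀ x y → x ⊆ᴹ y → S y → S x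
  ⊆ᴹ-set x y x⊆y sy = Subset y x sy x⊆y

  remove : (x z : M) → S z → M
  remove x z sz = x ∩ ∁ (singleton z sz)

  ∈-remove : ∀ {x z sz} w → S w → (w ∈ remove x z sz ⟺ (w ∈ x × w ≢ z))
  ∈-remove {x} {z} {sz} w sw =
    (λ w∈ → let (w∈x , w∈∁) = proj₁ (∈∩ x _ w sw) w∈ in
      w∈x , λ w≡z → proj₁ (∈∁ _ w sw) w∈∁ (subst (_∈ singleton z sz) (sym w≡z) (∈-singleton z sz))) ,
    λ (w∈x , w≢z) → proj₂ (∈∩ x _ w sw)
      (w∈x , proj₂ (∈∁ _ w sw) λ w∈ → w≢z (∈-singleton⇒≡ w sw w∈))

  remove-set⇒set : ∀ {x z} (sz : S z) → S (remove x z sz) → S x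
  remove-set⇒set {x} {z} sz sr with Adj (remove x z sz) z sr sz
  ... | w , sw , ∈w = Subset w x sw λ v sv v∈x → proj₂ (∈w v sv) (decide v sv v∈x (em {v ≡ z}))
    where
    decide : ∀ v → S v → v ∈ x → Dec (v ≡ z) → v ∈ remove x z sz ⊎ v ≡ z
    decide v sv v∈x (yes v≡z) = inj₂ v≡z
    decide v sv v∈x (no v≢z)  = inj₁ (proj₂ (∈-remove v sv) (v∈x , v≢z))

  DistinctAtomsBelow-∷ : ∀ {n x z g} (sz : S z) → z ∈ x → DistinctAtomsBelow n (remove x z sz) g →
                         DistinctAtomsBelow (suc n) x (singleton z sz ∷ g)
  DistinctAtomsBelow-∷ {x = x} {z} {g} sz z∈x (g-injective , g-below) =
    ∷-injective singleton∉g g-injective , below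
    where
    singleton∉g : ∀ i → g i ≢ singleton z sz
    singleton∉g i eq = proj₂ (proj₁ (∈-remove z sz) (proj₂ (g-below i) z sz
                         (subst (z ∈_) (sym eq) (∈-singleton z sz)))) refl
    below : ∀ i → IsAtom ((singleton z sz ∷ g) i) × (singleton z sz ∷ g) i ⊆ᴹ x
    below zero    = singleton-IsAtom z sz , singleton⊆ᴹ sz z∈x
    below (suc i) = proj₁ (g-below i) ,
                    λ w sw w∈ → proj₁ (proj₁ (∈-remove w sw) (proj₂ (g-below i) w sw w∈))

  boundedAtoms⇒set : ∀ n x → (∀ g → ¬ DistinctAtomsBelow (suc n) x g) → S x
  boundedAtoms⇒set n x few with em {∃ λ z → S z × z ∈ x}
  ... | no empty = Subset ∅ x ∅-set λ z sz z∈x → ⊥-elim (empty (z , sz , z∈x))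
  boundedAtoms⇒set zero x few | yes (z , sz , z∈x) =
    ⊥-elim (few _ (DistinctAtomsBelow-∷ {g = λ ()} sz z∈x ((λ ()) , (λ ()))))
  boundedAtoms⇒set (suc n) x few | yes (z , sz , z∈x) =
    remove-set⇒set sz (boundedAtoms⇒set n (remove x z sz) λ g atoms →
      few _ (DistinctAtomsBelow-∷ sz z∈x atoms))

  compl-meet-IsDiff : ∀ {X Y c m} → IsCompl Y c → IsMeet X c m → IsDiff X Y m
  compl-meet-IsDiff isCompl isMeet z sz =
    (λ z∈m → let (z∈X , z∈c) = proj₁ (IsMeet⇒∈⟺ isMeet z sz) z∈m in
      z∈X , proj₁ (IsCompl⇒∈⟺ isCompl z sz) z∈c) ,
    λ (z∈X , z∉Y) → proj₂ (IsMeet⇒∈⟺ isMeet z sz) (z∈X , proj₂ (IsCompl⇒∈⟺ isCompl z sz) z∉Y)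

module BAC⁺Model {ℓ : Level} (em : ExcludedMiddle ℓ) {M : Set ℓ} (S : M → Set ℓ)
  (_∈_ : M → M → Set ℓ) (bac⁺ : ClassTheory.BAC⁺ S _∈_) where
  open ClassTheory S _∈_
  open BAC⁺ bac⁺
  open Order _⊆ᴹ_
  open BACModel em S _∈_ bac

  split-¬set : ∀ x → ¬ S x → ∃ λ y → y ⊆ᴹ x × ¬ S y ×
                 (∀ c m → IsCompl y c → IsMeet x c m → ¬ S m)
  split-¬set x ¬sx with Sep x ¬sx
  ... | y , y⊆x , ¬sy , x∖y-¬set =
    y , y⊆x , ¬sy , λ c m isCompl isMeet → x∖y-¬set m (compl-meet-IsDiff isCompl isMeet)

  setsFormIdeal : IABA-Ideal S
  setsFormIdeal = record
    { iaba     = isIABA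
    ; ideal-0  = IsBottom⇒set
    ; ideal-¬1 = IsTop⇒¬set
    ; ideal-∨  = IsJoin-set
    ; ideal-↓  = ⊆ᴹ-set
    ; finite   = boundedAtoms⇒set
    ; split    = split-¬set
    }

mainTheorem17 : {ℓ : Level} → ExcludedMiddle ℓ →
                (M : Set ℓ) (S : M → Set ℓ) (_∈_ : M → M → Set ℓ) →
                ClassTheory.BAC⁺ S _∈_ →
                Order.IABA-Ideal (ClassTheory._⊆ᴹ_ S _∈_) S
                  × SameCard S (Order.IsAtom (ClassTheory._⊆ᴹ_ S _∈_))
mainTheorem17 em M S _∈_ bac⁺ =
  BAC⁺Model.setsFormIdeal em S _∈_ bac⁺ ,
  BACModel.sets≈atoms em S _∈_ (ClassTheory.BAC⁺.bac bac⁺)
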